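{- Fix $d\in\mathbb{N}$. If $\mathcal{C}$ is a graph class of tree rank at most $d$, then $\mathcal{C}$ has bounded expansion. Moreover, if $\mathcal{C}$ has elementary tree rank at most $d$, then there is an elementary function $f\colon\mathbb{N}\to\mathbb{N}$ such that $\tilde\nabla_r(G)\le f(r)$ for all $G\in\mathcal{C}$ and $r\in\mathbb{N}$.
   Context: Graphs are finite, simple, undirected. $H$ is an $r$-shallow topological minor of $G$ if $G$ contains as a subgraph a graph obtained from $H$ by replacing each edge $uv$ by a $u$–$v$ path with at most $r$ internal vertices; $\mathrm{TopMinors}_r(\mathcal{C})$ is the class of these for $G\in\mathcal{C}$. $\tilde\nabla_r(G)$ is the maximum of $2|E(H)|/|V(H)|$ over all $r$-shallow topological minors $H$ of $G$; $\mathcal{C}$ has bounded expansion if for every $r$ there is $c_r$ with $\tilde\nabla_r(G)\le c_r$ for all $G\in\mathcal{C}$. A rooted tree has depth equal to the maximum number of vertices on a root-to-leaf path; $\mathcal{T}_d$ is the class of trees of depth $d$. Tree rank: $\max\{d:\exists r,\ \mathcal{T}_d\subseteq\mathrm{TopMinors}_r(\mathcal{C})\}$. A function is elementary if bounded by $\mathsf{tower}(h,\cdot)$ for a fixed $h$, where $\mathsf{tower}(0,b)=b$, $\mathsf{tower}(a,b)=2^{\mathsf{tower}(a-1,b)}$. $\mathcal{C}$ has elementary tree rank at most $d$ if there is an elementary $f$ such that for every $r$ some tree of depth $d+1$ with $f(r)$ vertices is not in $\mathrm{TopMinors}_r(\mathcal{C})$. -}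

module Defs where

open import Level using (0ℓ)
open import Data.Nat using (ℕ; zero; suc; _+_; _*_; _^_; _≤_; _<_)
open import Data.Fin using (Fin; toℕ)
open import Data.Bool using (Bool; true; false; if_then_else_)
open import Data.List using (List; []; _∷_; _++_; length)
open import Data.List.Membership.Propositional using (_∈_; _∉_)
open import Data.List.Relation.Unary.Unique.Propositional using (Unique)
open import Data.Product using (Σ; ∃; ∃-syntax; _×_; _,_)
open import Data.Sum using (_⊎_)
open import Relation.Binary.PropositionalEquality using (_≡_; _≢_)
open import Relation.Nullary using (¬_)
open import Function.Definitions using (Injective)

record Graph : Set where
  field
    n      : ℕ
    adj    : Fin n → Fin n → Bool
    sym    : ∀ i j → adj i j ≡ adj j i
    irrefl : ∀ i → adj i i ≡ false
open Graph public

GraphClass : Set₁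
GraphClass = Graph → Set

∣V∣ : Graph → ℕ
∣V∣ G = n G

sumFin : (k : ℕ) → (Fin k → ℕ) → ℕ
sumFin zero    f = 0
sumFin (suc k) f = f Fin.zero + sumFin k (λ i → f (Fin.suc i))

∣E∣ : Graph → ℕ
∣E∣ G = sumFin (n G) λ i → sumFin (n G) λ j →
          if adj G i j then (if Data.Nat._<ᵇ_ (toℕ i) (toℕ j) then 1 else 0) else 0

IsEdge : (H : Graph) → Fin (n H) → Fin (n H) → Set
IsEdge H u v = (toℕ u < toℕ v) × (adj H u v ≡ true)

data Walk (G : Graph) : List (Fin (n G)) → Set where
  walk-[] : Walk G []
  walk-1  : ∀ x → Walk G (x ∷ [])
  walk-∷  : ∀ x y xs → adj G x y ≡ true → Walk G (y ∷ xs) → Walk G (x ∷ y ∷ xs)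

Disjoint : {A : Set} → List A → List A → Set
Disjoint xs ys = ∀ {x} → x ∈ xs → x ∉ ys

-- H is an r-shallow topological minor of G: G contains, as a (not
-- necessarily induced) subgraph, a subdivision of H in which every edge
-- uv is replaced by a u–v path with at most r internal vertices.
-- φ maps branch vertices injectively; P u v lists the internal vertices
-- of the path replacing the edge uv (u < v).

record ShallowTopMinor (r : ℕ) (H G : Graph) : Set where
  field
    φ      : Fin (n H) → Fin (n G)
    φ-inj  : Injective _≡_ _≡_ φ
    P      : Fin (n H) → Fin (n H) → List (Fin (n G))
    short  : ∀ u v → IsEdge H u v → length (P u v) ≤ r
    path   : ∀ u v → IsEdge H u v → Walk G (φ u ∷ P u v ++ φ v ∷ [])
    uniq   : ∀ u v → IsEdge H u v → Unique (P u v)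
    avoid  : ∀ u v → IsEdge H u v → ∀ w → φ w ∉ P u v
    disj   : ∀ u v u' v' → IsEdge H u v → IsEdge H u' v' →
             ¬ ((u ≡ u') × (v ≡ v')) → Disjoint (P u v) (P u' v')

TopMinors : ℕ → GraphClass → GraphClass
TopMinors r C H = ∃[ G ] (C G × ShallowTopMinor r H G)

-- ∇̃_r(G) ≤ c  (c natural; 2|E(H)|/|V(H)| ≤ c written multiplicatively)

∇̃≤ : ℕ → Graph → ℕ → Set
∇̃≤ r G c = ∀ H → ShallowTopMinor r H G → 2 * ∣E∣ H ≤ c * ∣V∣ H

BoundedExpansion : GraphClass → Set
BoundedExpansion C = ∀ r → ∃[ c ] (∀ G → C G → ∇̃≤ r G c)

-- Trees of depth d: a graph with a root ρ and a parent function p and a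
-- level function l (number of vertices on the path to the root), such
-- that the edges are exactly the parent edges, and the maximum level is d.

record RootedTreeOfDepth (d : ℕ) (T : Graph) : Set where
  field
    ρ        : Fin (n T)
    p        : Fin (n T) → Fin (n T)
    l        : Fin (n T) → ℕ
    l-root   : l ρ ≡ 1
    l-parent : ∀ v → v ≢ ρ → l v ≡ suc (l (p v))
    parent-e : ∀ v → v ≢ ρ → adj T v (p v) ≡ true
    edges    : ∀ u v → adj T u v ≡ true →
               ((u ≢ ρ) × (p u ≡ v)) ⊎ ((v ≢ ρ) × (p v ≡ u))
    l-≤      : ∀ v → l v ≤ d
    l-max    : ∃[ v ] (l v ≡ d)

IsTreeOfDepth : ℕ → Graph → Set
IsTreeOfDepth d T = RootedTreeOfDepth d T

TreesIn : ℕ → ℕ → GraphClass → Set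
TreesIn d r C = ∀ T → IsTreeOfDepth d T → TopMinors r C T

TreeRankAtMost : ℕ → GraphClass → Set
TreeRankAtMost d C = ∀ d' r → TreesIn d' r C → d' ≤ d

tower : ℕ → ℕ → ℕ
tower zero    b = b
tower (suc a) b = 2 ^ tower a b

Elementary : (ℕ → ℕ) → Set
Elementary f = ∃[ h ] (∀ x → f x ≤ tower h x)

ElementaryTreeRankAtMost : ℕ → GraphClass → Set
ElementaryTreeRankAtMost d C =
  ∃[ f ] (Elementary f ×
    (∀ r → ∃[ T ] (IsTreeOfDepth (suc d) T × (∣V∣ T ≡ f r) × ¬ TopMinors r C T)))

-- Fix a tree T of depth d + 1 that is not an r-shallow topological minor of any graph in C
-- (tree rank at most d yields one classically, elementary tree rank one with f(r) vertices).
-- No r-shallow topological minor H of a graph G ∈ C has 2|E(H)| > 4|T||V(H)|: otherwise the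
-- degree sum of H exceeds 2|T||V(H)|, so repeatedly deleting vertices of degree below |T|
-- leaves a nonempty subgraph of minimum degree |T|, into which T embeds greedily, each vertex
-- after its parent; and a subgraph of an r-shallow topological minor is again one.
-- Hence ∇̃_r(G) ≤ 4|T|, and r ↦ 4 f(r) is again elementary.
module Submission where

open import Defs
open import Level using (0ℓ)
open import Data.Nat using (ℕ)
open import Data.Product using (_×_; ∃-syntax)
open import Axiom.ExcludedMiddle using (ExcludedMiddle)

open import Axiom.DoubleNegationElimination using (em⇒dne)
open import Data.Bool using (Bool; true; false; if_then_else_)
import Data.Bool.Properties as Bool
open import Data.Fin using (Fin; toℕ) renaming (zero to fzero; suc to fsuc)
open import Data.Fin.Properties using (toℕ-injective; _≟_; all?; ¬∀⟶∃¬)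
open import Data.List using (List; []; _∷_; _++_; _ʳ++_; _∷ʳ_; length; reverse; map; filter; tabulate; allFin)
open import Data.List.Properties using (length-map; length-reverse; length-tabulate; map-cong; reverse-++; unfold-reverse)
open import Data.List.Membership.Propositional using (_∈_; _∉_; find; lose)
open import Data.List.Membership.Propositional.Properties using (∈-∃++; ∈-allFin; ∈-map⁺; ∈-filter⁻)
import Data.List.Membership.DecPropositional as DecMembership
open import Data.List.Relation.Binary.Permutation.Propositional using (_↭_; ↭-sym; ↭⇒↭ₛ)
open import Data.List.Relation.Binary.Permutation.Propositional.Properties
  using (shift; ↭-length; ↭-reverse; ∈-resp-↭; filter-↭; map⁺)
import Data.List.Relation.Binary.Permutation.Setoid.Properties as SetoidPermutation
import Data.List.Relation.Unary.All as All
open import Data.List.Relation.Unary.All.Properties using (¬Any⇒All¬)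
open import Data.List.Relation.Unary.AllPairs as AllPairs using (_∷_)
open import Data.List.Relation.Unary.Any using (here; there; any?)
open import Data.List.Relation.Unary.Any.Properties using (reverse⁻)
open import Data.List.Relation.Unary.Unique.Propositional using (Unique)
open import Data.List.Relation.Unary.Unique.Propositional.Properties using (allFin⁺; filter⁺)
open import Data.Nat using (zero; suc; _+_; _*_; _^_; _≤_; _<_; z≤n; s≤s; _<?_; _<ᵇ_)
open import Data.Nat.ListAction using (sum)
open import Data.Nat.ListAction.Properties using (sum-↭)
open import Data.Nat.Properties
  using (≤-refl; ≤-reflexive; ≤-trans; <⇒≤; <-≤-trans; ≤∧≢⇒<; ≮⇒≥; ≰⇒>; ≤⇒≯; <⇒≱; <-asym; 1+n≰n;
         suc-injective; m≤m+n; +-assoc; +-comm; +-suc; +-identityʳ; *-suc; *-assoc;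
         +-mono-≤; +-monoʳ-≤; *-monoʳ-≤; ^-monoʳ-≤; +-cancelʳ-<; *-cancelˡ-<; _≤?_; module ≤-Reasoning)
open import Data.Product using (_,_; ∃₂; proj₁; proj₂)
open import Data.Sum using (_⊎_; inj₁; inj₂)
open import Data.Vec.Functional using (updateAt)
open import Data.Vec.Functional.Properties using (updateAt-updates; updateAt-minimal)
open import Function using (_∘_; const)
open import Relation.Binary.PropositionalEquality as ≡ using (_≡_; _≢_; refl; cong; cong₂; subst)
open import Relation.Nullary using (¬_; Dec; yes; no; ¬?; contradiction)
open import Relation.Nullary.Decidable using (decidable-stable; _×-dec_)

module _ {A : Set} where

  ∈⇒↭∷ : ∀ {x : A} {xs} → x ∈ xs → ∃[ ys ] (xs ↭ x ∷ ys)
  ∈⇒↭∷ x∈xs with ∈-∃++ x∈xs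
  ... | as , bs , refl = as ++ bs , shift _ as bs

  Unique-resp-↭ : ∀ {xs ys : List A} → xs ↭ ys → Unique xs → Unique ys
  Unique-resp-↭ σ = SetoidPermutation.Unique-resp-↭ (≡.setoid A) (↭⇒↭ₛ σ)

  Unique-reverse : ∀ {xs : List A} → Unique xs → Unique (reverse xs)
  Unique-reverse {xs} = Unique-resp-↭ (↭-sym (↭-reverse xs))

  Unique-⊆⇒length-≤ : ∀ {xs ys : List A} → Unique xs → (∀ {z} → z ∈ xs → z ∈ ys) →
                      length xs ≤ length ys
  Unique-⊆⇒length-≤ {[]} _ _ = z≤n
  Unique-⊆⇒length-≤ {x ∷ xs} {ys} (x∉xs ∷ xs-unique) xs⊆ys with ∈⇒↭∷ (xs⊆ys (here refl))
  ... | ys' , σ = ≤-trans (s≤s (Unique-⊆⇒length-≤ xs-unique xs⊆ys')) (≤-reflexive (≡.sym (↭-length σ)))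
    where
    xs⊆ys' : ∀ {z} → z ∈ xs → z ∈ ys'
    xs⊆ys' z∈xs with ∈-resp-↭ σ (xs⊆ys (there z∈xs))
    ... | here refl = contradiction refl (All.lookup x∉xs z∈xs)
    ... | there z∈ys' = z∈ys'

Unique-length-≤ : ∀ {m} {xs : List (Fin m)} → Unique xs → length xs ≤ m
Unique-length-≤ {m} xs-unique =
  ≤-trans (Unique-⊆⇒length-≤ xs-unique (λ {z} _ → ∈-allFin z)) (≤-reflexive (length-tabulate (λ i → i)))

_∈?_ : ∀ {m} (v : Fin m) (xs : List (Fin m)) → Dec (v ∈ xs)
_∈?_ = DecMembership._∈?_ _≟_

sumFin-≤-sum-tabulate : ∀ k {A : Set} {f : Fin k → ℕ} (g : A → ℕ) (h : Fin k → A) →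
                        (∀ i → f i ≤ g (h i)) → sumFin k f ≤ sum (map g (tabulate h))
sumFin-≤-sum-tabulate zero    g h f≤ = z≤n
sumFin-≤-sum-tabulate (suc k) g h f≤ = +-mono-≤ (f≤ fzero) (sumFin-≤-sum-tabulate k g (h ∘ fsuc) (f≤ ∘ fsuc))

SamePair : {A : Set} → A → A → A → A → Set
SamePair a b c d = (a ≡ c × b ≡ d) ⊎ (a ≡ d × b ≡ c)

module _ {A : Set} {a b c d : A} where

  SamePair-sym : SamePair a b c d → SamePair c d a b
  SamePair-sym (inj₁ (refl , refl)) = inj₁ (refl , refl)
  SamePair-sym (inj₂ (refl , refl)) = inj₂ (refl , refl)

  SamePair-trans : ∀ {e f} → SamePair a b c d → SamePair c d e f → SamePair a b e f
  SamePair-trans (inj₁ (refl , refl)) q = q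
  SamePair-trans (inj₂ (refl , refl)) (inj₁ (refl , refl)) = inj₂ (refl , refl)
  SamePair-trans (inj₂ (refl , refl)) (inj₂ (refl , refl)) = inj₁ (refl , refl)

adj⇒≢ : ∀ (G : Graph) {a b} → adj G a b ≡ true → a ≢ b
adj⇒≢ G {a} a~a refl with ≡.trans (≡.sym a~a) (irrefl G a)
... | ()

module _ (G : Graph) where

  Walk-ʳ++ : ∀ {x xs acc} → Walk G (x ∷ xs) → Walk G (x ∷ acc) → Walk G ((x ∷ xs) ʳ++ acc)
  Walk-ʳ++ (walk-1 _) w = w
  Walk-ʳ++ (walk-∷ x y _ x~y w) w' = Walk-ʳ++ w (walk-∷ y x _ (≡.trans (sym G y x) x~y) w')

  Walk-reverse : ∀ {xs} → Walk G xs → Walk G (reverse xs)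
  Walk-reverse walk-[] = walk-[]
  Walk-reverse w@(walk-1 x) = Walk-ʳ++ w (walk-1 x)
  Walk-reverse w@(walk-∷ x _ _ _ _) = Walk-ʳ++ w (walk-1 x)

reverse-between : ∀ {A : Set} (a b : A) xs → reverse (a ∷ xs ++ b ∷ []) ≡ b ∷ reverse xs ++ a ∷ []
reverse-between a b xs = begin
  reverse (a ∷ xs ++ b ∷ [])    ≡⟨ unfold-reverse a (xs ++ b ∷ []) ⟩
  reverse (xs ++ b ∷ []) ∷ʳ a   ≡⟨ cong (_∷ʳ a) (reverse-++ xs (b ∷ [])) ⟩
  b ∷ reverse xs ++ a ∷ []      ∎
  where open ≡.≡-Reasoning

record SubgraphEmbedding (T H : Graph) : Set where
  field
    embed           : Fin (n T) → Fin (n H)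
    embed-injective : ∀ {u v} → embed u ≡ embed v → u ≡ v
    embed-adj       : ∀ {u v} → adj T u v ≡ true → adj H (embed u) (embed v) ≡ true

module OrientedPaths {r : ℕ} {H G : Graph} (M : ShallowTopMinor r H G) where
  open ShallowTopMinor M

  -- M provides the path of an edge uv only for toℕ u < toℕ v; orientedPath a b runs from a to b.
  orientedPath : Fin (n H) → Fin (n H) → List (Fin (n G))
  orientedPath a b with toℕ a <? toℕ b
  ... | yes _ = P a b
  ... | no  _ = reverse (P b a)

  data OrientedEdge (a b : Fin (n H)) : List (Fin (n G)) → Set where
    forward  : IsEdge H a b → OrientedEdge a b (P a b)
    backward : IsEdge H b a → OrientedEdge a b (reverse (P b a))

  orient : ∀ {a b} → adj H a b ≡ true → OrientedEdge a b (orientedPath a b)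
  orient {a} {b} a~b with toℕ a <? toℕ b
  ... | yes a<b = forward (a<b , a~b)
  ... | no  a≮b = backward (b<a , ≡.trans (sym H b a) a~b)
    where
    b<a : toℕ b < toℕ a
    b<a = ≤∧≢⇒< (≮⇒≥ a≮b) (λ b≡a → adj⇒≢ H a~b (toℕ-injective (≡.sym b≡a)))

  module _ {a b : Fin (n H)} {Q : List (Fin (n G))} where

    OrientedEdge-short : OrientedEdge a b Q → length Q ≤ r
    OrientedEdge-short (forward e)  = short a b e
    OrientedEdge-short (backward e) = subst (_≤ r) (≡.sym (length-reverse (P b a))) (short b a e)

    OrientedEdge-walk : OrientedEdge a b Q → Walk G (φ a ∷ Q ++ φ b ∷ [])
    OrientedEdge-walk (forward e)  = path a b e
    OrientedEdge-walk (backward e) =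
      subst (Walk G) (reverse-between (φ b) (φ a) (P b a)) (Walk-reverse G (path b a e))

    OrientedEdge-unique : OrientedEdge a b Q → Unique Q
    OrientedEdge-unique (forward e)  = uniq a b e
    OrientedEdge-unique (backward e) = Unique-reverse (uniq b a e)

    OrientedEdge-∈ : OrientedEdge a b Q → ∀ {z} → z ∈ Q →
                     ∃₂ λ c c' → IsEdge H c c' × SamePair a b c c' × z ∈ P c c'
    OrientedEdge-∈ (forward e)  z∈ = a , b , e , inj₁ (refl , refl) , z∈
    OrientedEdge-∈ (backward e) z∈ = b , a , e , inj₂ (refl , refl) , reverse⁻ z∈

    OrientedEdge-avoids : OrientedEdge a b Q → ∀ w → φ w ∉ Q
    OrientedEdge-avoids o w φw∈ with OrientedEdge-∈ o φw∈
    ... | c , c' , e , _ , φw∈P = avoid c c' e w φw∈P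

  OrientedEdge-shared : ∀ {a b a' b' Q Q'} → OrientedEdge a b Q → OrientedEdge a' b' Q' →
                        ∀ {z} → z ∈ Q → z ∈ Q' → SamePair a b a' b'
  OrientedEdge-shared o o' z∈ z∈' with OrientedEdge-∈ o z∈ | OrientedEdge-∈ o' z∈'
  ... | c , c' , e , ab≈cc' , z∈P | d , d' , e' , a'b'≈dd' , z∈P' with (c ≟ d) ×-dec (c' ≟ d')
  ... | no different = contradiction z∈P' (disj c c' d d' e e' different z∈P)
  ... | yes (refl , refl) = SamePair-trans ab≈cc' (SamePair-sym a'b'≈dd')

shallowTopMinor-of-subgraph : ∀ {r T H G} → SubgraphEmbedding T H → ShallowTopMinor r H G →
                              ShallowTopMinor r T G
shallowTopMinor-of-subgraph {r} {T} {H} {G} ι M = record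
  { φ     = φ ∘ embed
  ; φ-inj = embed-injective ∘ φ-inj
  ; P     = λ u v → orientedPath (embed u) (embed v)
  ; short = λ u v e → OrientedEdge-short (orient′ e)
  ; path  = λ u v e → OrientedEdge-walk (orient′ e)
  ; uniq  = λ u v e → OrientedEdge-unique (orient′ e)
  ; avoid = λ u v e w → OrientedEdge-avoids (orient′ e) (embed w)
  ; disj  = λ u v u' v' → disjoint
  }
  where
  open SubgraphEmbedding ι
  open ShallowTopMinor M using (φ; φ-inj)
  open OrientedPaths M

  orient′ : ∀ {u v} → IsEdge T u v → OrientedEdge (embed u) (embed v) (orientedPath (embed u) (embed v))
  orient′ (_ , u~v) = orient (embed-adj u~v)

  disjoint : ∀ {u v u' v'} → IsEdge T u v → IsEdge T u' v' → ¬ (u ≡ u' × v ≡ v') →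
             Disjoint (orientedPath (embed u) (embed v)) (orientedPath (embed u') (embed v'))
  disjoint e e' different z∈ z∈' with OrientedEdge-shared (orient′ e) (orient′ e') z∈ z∈'
  ... | inj₁ (uu' , vv') = different (embed-injective uu' , embed-injective vv')
  ... | inj₂ (uv' , vu') with embed-injective uv' | embed-injective vu' | e | e'
  ...   | refl | refl | (u<v , _) | (v<u , _) = <-asym u<v v<u

module Degree (H : Graph) where

  Vertex : Set
  Vertex = Fin (n H)

  neighboursIn : List Vertex → Vertex → List Vertex
  neighboursIn S x = filter (λ y → adj H x y Bool.≟ true) S

  degreeIn : List Vertex → Vertex → ℕ
  degreeIn S x = length (neighboursIn S x)

  degreeSum : List Vertex → ℕ
  degreeSum S = sum (map (degreeIn S) S)

  ∈-neighboursIn⁻ : ∀ S {x y} → y ∈ neighboursIn S x → y ∈ S × adj H x y ≡ true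
  ∈-neighboursIn⁻ S = ∈-filter⁻ _

  neighboursIn-unique : ∀ {S} x → Unique S → Unique (neighboursIn S x)
  neighboursIn-unique x = filter⁺ _

  degreeIn-↭ : ∀ {S S'} → S ↭ S' → ∀ x → degreeIn S x ≡ degreeIn S' x
  degreeIn-↭ σ x = ↭-length (filter-↭ _ σ)

  degreeSum-↭ : ∀ {S S'} → S ↭ S' → degreeSum S ≡ degreeSum S'
  degreeSum-↭ {S} {S'} σ = ≡.trans (cong sum (map-cong (degreeIn-↭ σ) S)) (sum-↭ (map⁺ _ σ))

  degreeIn-∷-self : ∀ x S → degreeIn (x ∷ S) x ≡ degreeIn S x
  degreeIn-∷-self x S rewrite irrefl H x = refl

  sum-degreeIn-∷ : ∀ x R L → sum (map (degreeIn (x ∷ R)) L) ≡ sum (map (degreeIn R) L) + degreeIn L x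
  sum-degreeIn-∷ x R []      = refl
  sum-degreeIn-∷ x R (y ∷ L) rewrite sym H x y with adj H y x
  ... | true  = begin
    suc (degreeIn R y + sum (map (degreeIn (x ∷ R)) L))
      ≡⟨ cong (suc ∘ (degreeIn R y +_)) (sum-degreeIn-∷ x R L) ⟩
    suc (degreeIn R y + (sum (map (degreeIn R) L) + degreeIn L x)) ≡⟨ cong suc (+-assoc (degreeIn R y) _ _) ⟨
    suc (degreeIn R y + sum (map (degreeIn R) L) + degreeIn L x)   ≡⟨ +-suc _ (degreeIn L x) ⟨
    degreeIn R y + sum (map (degreeIn R) L) + suc (degreeIn L x)   ∎
    where open ≡.≡-Reasoning
  ... | false = ≡.trans (cong (degreeIn R y +_) (sum-degreeIn-∷ x R L)) (≡.sym (+-assoc (degreeIn R y) _ _))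

  degreeSum-∷ : ∀ x R → degreeSum (x ∷ R) ≡ degreeSum R + 2 * degreeIn R x
  degreeSum-∷ x R = begin
    degreeIn (x ∷ R) x + sum (map (degreeIn (x ∷ R)) R)
      ≡⟨ cong₂ _+_ (degreeIn-∷-self x R) (sum-degreeIn-∷ x R R) ⟩
    d + (degreeSum R + d)                               ≡⟨ +-comm d _ ⟩
    degreeSum R + d + d                                 ≡⟨ +-assoc (degreeSum R) d d ⟩
    degreeSum R + (d + d)                               ≡⟨ cong (λ t → degreeSum R + (d + t)) (+-identityʳ d) ⟨
    degreeSum R + 2 * d                                 ∎
    where
    open ≡.≡-Reasoning
    d : ℕ
    d = degreeIn R x

  edgeRow-≤-degree : ∀ x k (h : Fin k → Vertex) (c : Fin k → Bool) →
    sumFin k (λ j → if adj H x (h j) then (if c j then 1 else 0) else 0) ≤ degreeIn (tabulate h) x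
  edgeRow-≤-degree x zero    h c = z≤n
  edgeRow-≤-degree x (suc k) h c with adj H x (h fzero)
  ... | false = edgeRow-≤-degree x k (h ∘ fsuc) (c ∘ fsuc)
  ... | true  = +-mono-≤ (bit≤1 (c fzero)) (edgeRow-≤-degree x k (h ∘ fsuc) (c ∘ fsuc))
    where
    bit≤1 : ∀ b → (if b then 1 else 0) ≤ 1
    bit≤1 true  = ≤-refl
    bit≤1 false = z≤n

  ∣E∣-≤-degreeSum : ∣E∣ H ≤ degreeSum (allFin (n H))
  ∣E∣-≤-degreeSum = sumFin-≤-sum-tabulate (n H) (degreeIn (allFin (n H))) (λ i → i)
    (λ i → edgeRow-≤-degree i (n H) (λ j → j) (λ j → toℕ i <ᵇ toℕ j))

  record MinDegreeSubgraph (k : ℕ) : Set where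
    field
      vertices        : List Vertex
      vertices-unique : Unique vertices
      nonempty        : ∃[ x ] (x ∈ vertices)
      minDegree       : ∀ {x} → x ∈ vertices → k ≤ degreeIn vertices x

  dense-after-removal : ∀ k m D d → 2 * k * suc m < D + 2 * d → d < k → 2 * k * m < D
  dense-after-removal k m D d dense d<k = +-cancelʳ-< (2 * k) (2 * k * m) D (begin-strict
    2 * k * m + 2 * k ≡⟨ +-comm (2 * k * m) (2 * k) ⟩
    2 * k + 2 * k * m ≡⟨ *-suc (2 * k) m ⟨
    2 * k * suc m     <⟨ dense ⟩
    D + 2 * d         ≤⟨ +-monoʳ-≤ D (*-monoʳ-≤ 2 (<⇒≤ d<k)) ⟩
    D + 2 * k         ∎)
    where open ≤-Reasoning

  -- Peeling a vertex of degree < k keeps the average degree above 2k.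
  minDegreeSubgraph : ∀ k S → Unique S → 2 * k * length S < degreeSum S → MinDegreeSubgraph k
  minDegreeSubgraph k S = peel (length S) S refl
    where
    peel : ∀ m S → length S ≡ m → Unique S → 2 * k * m < degreeSum S → MinDegreeSubgraph k
    peel m       []            _    _        ()
    peel zero    (_ ∷ _)       ()   _        _
    peel (suc m) S@(x ∷ _)     |S|≡ S-unique dense with any? (λ y → degreeIn S y <? k) S
    ... | no ¬low = record
      { vertices = S ; vertices-unique = S-unique ; nonempty = x , here refl
      ; minDegree = λ y∈S → ≮⇒≥ (¬low ∘ lose y∈S) }
    ... | yes low with find low
    ... | y , y∈S , low-y with ∈⇒↭∷ y∈S
    ... | R , σ with Unique-resp-↭ σ S-unique
    ... | _ ∷ R-unique = peel m R |R|≡ R-unique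
      (dense-after-removal k m (degreeSum R) (degreeIn R y)
        (subst (2 * k * suc m <_) (≡.trans (degreeSum-↭ σ) (degreeSum-∷ y R)) dense)
        (subst (_< k) (≡.trans (degreeIn-↭ σ y) (degreeIn-∷-self y R)) low-y))
      where
      |R|≡ : length R ≡ m
      |R|≡ = suc-injective (≡.trans (≡.sym (↭-length σ)) |S|≡)

  module _ {k} (K : MinDegreeSubgraph k) where
    open MinDegreeSubgraph K

    freshNeighbour : ∀ {y} (X : List Vertex) → y ∈ vertices → length X < k →
                     ∃[ z ] (z ∈ neighboursIn vertices y × z ∉ X)
    freshNeighbour {y} X y∈ |X|<k with any? (λ z → ¬? (z ∈? X)) (neighboursIn vertices y)
    ... | yes fresh = find fresh
    ... | no ¬fresh = contradiction |X|<k (≤⇒≯ (begin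
      k                   ≤⟨ minDegree y∈ ⟩
      degreeIn vertices y ≤⟨ Unique-⊆⇒length-≤ (neighboursIn-unique y vertices-unique) covered ⟩
      length X            ∎))
      where
      open ≤-Reasoning
      covered : ∀ {z} → z ∈ neighboursIn vertices y → z ∈ X
      covered {z} z∈N = decidable-stable (z ∈? X) (¬fresh ∘ lose z∈N)

module _ {d : ℕ} {T : Graph} (R : RootedTreeOfDepth d T) where
  open RootedTreeOfDepth R

  boundaryVertex : ∀ {D} → ρ ∈ D → ∀ {w} → w ∉ D → ∃[ w' ] (w' ∉ D × p w' ∈ D)
  boundaryVertex {D} ρ∈D {w} = climb (l w) w ≤-refl
    where
    climb : ∀ k w → l w ≤ k → w ∉ D → ∃[ w' ] (w' ∉ D × p w' ∈ D)
    climb k w lw≤k w∉D with p w ∈? D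
    ... | yes pw∈D = w , w∉D , pw∈D
    -- l w = 1 + l (p w) rules out k = 0.
    ... | no  pw∉D with k | subst (_≤ k) (l-parent w (λ { refl → w∉D ρ∈D })) lw≤k
    ...   | suc k' | s≤s lpw≤k' = climb k' (p w) lpw≤k' pw∉D

module GreedyEmbedding {d : ℕ} {T H : Graph} (R : RootedTreeOfDepth d T)
                       (K : Degree.MinDegreeSubgraph H (n T)) where
  open RootedTreeOfDepth R
  open Degree H
  open MinDegreeSubgraph K

  record PartialEmbedding (D : List (Fin (n T))) : Set where
    field
      ψ           : Fin (n T) → Vertex
      D-unique    : Unique D
      root∈       : ρ ∈ D
      parent∈     : ∀ {v} → v ∈ D → v ≢ ρ → p v ∈ D
      ψ-parent    : ∀ {v} → v ∈ D → v ≢ ρ → adj H (ψ v) (ψ (p v)) ≡ true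
      ψ-injective : ∀ {u v} → u ∈ D → v ∈ D → ψ u ≡ ψ v → u ≡ v
      ψ-vertices  : ∀ {v} → v ∈ D → ψ v ∈ vertices

  rootEmbedding : PartialEmbedding (ρ ∷ [])
  rootEmbedding = record
    { ψ = const (proj₁ nonempty) ; D-unique = All.[] ∷ AllPairs.[] ; root∈ = here refl
    ; parent∈ = λ { (here refl) ρ≢ρ → contradiction refl ρ≢ρ }
    ; ψ-parent = λ { (here refl) ρ≢ρ → contradiction refl ρ≢ρ }
    ; ψ-injective = λ { (here refl) (here refl) _ → refl }
    ; ψ-vertices = λ _ → proj₂ nonempty }

  extend : ∀ {D} (E : PartialEmbedding D) → let open PartialEmbedding E in
           ∀ {w z} → w ∉ D → p w ∈ D → z ∈ neighboursIn vertices (ψ (p w)) → z ∉ map ψ D →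
           PartialEmbedding (w ∷ D)
  extend {D} E {w} {z} w∉D pw∈D z∈N z∉ψD = record
    { ψ = ψ′ ; D-unique = ¬Any⇒All¬ D w∉D ∷ D-unique ; root∈ = there root∈
    ; parent∈ = parent∈′ ; ψ-parent = ψ-parent′ ; ψ-injective = ψ-injective′ ; ψ-vertices = ψ-vertices′ }
    where
    open PartialEmbedding E
    ψ′ : Fin (n T) → Vertex
    ψ′ = updateAt ψ w (const z)

    ψ′-new : ψ′ w ≡ z
    ψ′-new = updateAt-updates w ψ

    ψ′-old : ∀ {v} → v ∈ D → ψ′ v ≡ ψ v
    ψ′-old {v} v∈D = updateAt-minimal v w ψ (λ { refl → w∉D v∈D })

    parent∈′ : ∀ {v} → v ∈ w ∷ D → v ≢ ρ → p v ∈ w ∷ D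
    parent∈′ (here refl) _   = there pw∈D
    parent∈′ (there v∈D) v≢ρ = there (parent∈ v∈D v≢ρ)

    ψ-parent′ : ∀ {v} → v ∈ w ∷ D → v ≢ ρ → adj H (ψ′ v) (ψ′ (p v)) ≡ true
    ψ-parent′ (here refl) _ rewrite ψ′-new | ψ′-old pw∈D =
      ≡.trans (sym H z (ψ (p w))) (proj₂ (∈-neighboursIn⁻ vertices z∈N))
    ψ-parent′ (there v∈D) v≢ρ rewrite ψ′-old v∈D | ψ′-old (parent∈ v∈D v≢ρ) = ψ-parent v∈D v≢ρ

    new∉ : ∀ {v} → v ∈ D → ψ′ w ≢ ψ′ v
    new∉ v∈D eq = z∉ψD (subst (_∈ map ψ D) ψv≡z (∈-map⁺ ψ v∈D))
      where
      ψv≡z : ψ _ ≡ z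
      ψv≡z = ≡.trans (≡.sym (ψ′-old v∈D)) (≡.trans (≡.sym eq) ψ′-new)

    ψ-injective′ : ∀ {u v} → u ∈ w ∷ D → v ∈ w ∷ D → ψ′ u ≡ ψ′ v → u ≡ v
    ψ-injective′ (here refl)  (here refl)  _  = refl
    ψ-injective′ (here refl)  (there v∈D)  eq = contradiction eq (new∉ v∈D)
    ψ-injective′ (there u∈D)  (here refl)  eq = contradiction (≡.sym eq) (new∉ u∈D)
    ψ-injective′ (there u∈D)  (there v∈D)  eq =
      ψ-injective u∈D v∈D (≡.trans (≡.sym (ψ′-old u∈D)) (≡.trans eq (ψ′-old v∈D)))

    ψ-vertices′ : ∀ {v} → v ∈ w ∷ D → ψ′ v ∈ vertices
    ψ-vertices′ (here refl) = subst (_∈ vertices) (≡.sym ψ′-new) (proj₁ (∈-neighboursIn⁻ vertices z∈N))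
    ψ-vertices′ (there v∈D) = subst (_∈ vertices) (≡.sym (ψ′-old v∈D)) (ψ-vertices v∈D)

  extendAtBoundary : ∀ {D} → PartialEmbedding D → ¬ (∀ v → v ∈ D) → ∃[ w ] PartialEmbedding (w ∷ D)
  extendAtBoundary {D} E ¬covers =
    let v , v∉D       = ¬∀⟶∃¬ (n T) (_∈ D) (_∈? D) ¬covers
        w , w∉D , pw∈D = boundaryVertex R root∈ v∉D
        |ψD|<m = subst (_< n T) (≡.sym (length-map ψ D)) (Unique-length-≤ (¬Any⇒All¬ D v∉D ∷ D-unique))
        z , z∈N , z∉ψD = freshNeighbour K (map ψ D) (ψ-vertices pw∈D) |ψD|<m
    in w , extend E w∉D pw∈D z∈N z∉ψD
    where open PartialEmbedding E

  totalEmbedding : ∀ {D} → PartialEmbedding D → (∀ v → v ∈ D) → SubgraphEmbedding T H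
  totalEmbedding E covers = record
    { embed = ψ ; embed-injective = ψ-injective (covers _) (covers _) ; embed-adj = embed-adj }
    where
    open PartialEmbedding E
    embed-adj : ∀ {u v} → adj T u v ≡ true → adj H (ψ u) (ψ v) ≡ true
    embed-adj {u} {v} u~v with edges u v u~v
    ... | inj₁ (u≢ρ , refl) = ψ-parent (covers u) u≢ρ
    ... | inj₂ (v≢ρ , refl) = ≡.trans (sym H (ψ u) (ψ v)) (ψ-parent (covers v) v≢ρ)

  grow : ∀ k {D} → PartialEmbedding D → n T ≤ k + length D → SubgraphEmbedding T H
  grow k {D} E m≤ with all? (_∈? D)
  ... | yes covers = totalEmbedding E covers
  grow zero    {D} E m≤ | no ¬covers = contradiction covers ¬covers
    where
    covers : ∀ v → v ∈ D
    covers v = decidable-stable (v ∈? D) λ v∉D →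
      <⇒≱ (Unique-length-≤ (¬Any⇒All¬ D v∉D ∷ PartialEmbedding.D-unique E)) m≤
  grow (suc k) {D} E m≤ | no ¬covers with extendAtBoundary E ¬covers
  ... | _ , E′ = grow k E′ (subst (n T ≤_) (≡.sym (+-suc k (length D))) m≤)

  treeEmbedding : SubgraphEmbedding T H
  treeEmbedding = grow (n T) rootEmbedding (m≤m+n (n T) 1)

denseGraph-contains-tree : ∀ {d T H} → RootedTreeOfDepth d T → 2 * n T * n H < ∣E∣ H →
                           SubgraphEmbedding T H
denseGraph-contains-tree {T = T} {H} R dense = GreedyEmbedding.treeEmbedding R
  (minDegreeSubgraph (n T) (allFin (n H)) (allFin⁺ (n H))
    (subst (λ m → 2 * n T * m < degreeSum (allFin (n H))) (≡.sym (length-tabulate (λ i → i)))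
      (<-≤-trans dense ∣E∣-≤-degreeSum)))
  where open Degree H

-- The constant is 4 rather than 2 because only |E(H)| ≤ degreeSum is used.
∇̃≤-of-excluded-tree : ∀ {d r T C G} → RootedTreeOfDepth d T → ¬ TopMinors r C T → C G →
                      ∇̃≤ r G (4 * n T)
∇̃≤-of-excluded-tree {T = T} {G = G} R T∉ G∈C H M with 2 * ∣E∣ H ≤? 4 * n T * n H
... | yes sparse = sparse
... | no  dense  = contradiction (G , G∈C , shallowTopMinor-of-subgraph (denseGraph-contains-tree R dense′) M) T∉
  where
  dense′ : 2 * n T * n H < ∣E∣ H
  dense′ = *-cancelˡ-< 2 (2 * n T * n H) (∣E∣ H)
    (subst (_< 2 * ∣E∣ H) (≡.trans (cong (_* n H) (*-assoc 2 2 (n T))) (*-assoc 2 (2 * n T) (n H))) (≰⇒> dense))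

excludedTree : ExcludedMiddle 0ℓ → ∀ {d C} → TreeRankAtMost d C →
               ∀ r → ∃[ T ] (IsTreeOfDepth (suc d) T × ¬ TopMinors r C T)
excludedTree em {d} rank r = em⇒dne em λ none →
  1+n≰n (rank (suc d) r (λ T T-tree → em⇒dne em λ T∉ → none (T , T-tree , T∉)))

n<2^n : ∀ m → m < 2 ^ m
n<2^n zero    = s≤s z≤n
n<2^n (suc m) = +-mono-≤ {1} (≤-trans (s≤s z≤n) (n<2^n m)) (≤-trans (n<2^n m) (m≤m+n (2 ^ m) 0))

4*n≤tower3 : ∀ m → 4 * m ≤ tower 3 m
4*n≤tower3 m = begin
  4 * m              ≤⟨ *-monoʳ-≤ 4 (<⇒≤ (n<2^n m)) ⟩
  4 * 2 ^ m          ≡⟨ *-assoc 2 2 (2 ^ m) ⟩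
  2 ^ (2 + m)        ≤⟨ ^-monoʳ-≤ 2 (≤-trans (n<2^n (suc m)) (^-monoʳ-≤ 2 (n<2^n m))) ⟩
  tower 3 m          ∎
  where open ≤-Reasoning

tower-+ : ∀ a h m → tower a (tower h m) ≡ tower (a + h) m
tower-+ zero    h m = refl
tower-+ (suc a) h m = cong (2 ^_) (tower-+ a h m)

Elementary-4* : ∀ {f} → Elementary f → Elementary (λ m → 4 * f m)
Elementary-4* {f} (h , f≤) = 3 + h , λ m → begin
  4 * f m              ≤⟨ *-monoʳ-≤ 4 (f≤ m) ⟩
  4 * tower h m        ≤⟨ 4*n≤tower3 (tower h m) ⟩
  tower 3 (tower h m)  ≡⟨ tower-+ 3 h m ⟩
  tower (3 + h) m      ∎
  where open ≤-Reasoning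

proposition7p2 : (d : ℕ) (C : GraphClass) →
    (ExcludedMiddle 0ℓ → TreeRankAtMost d C → BoundedExpansion C) ×
    (ElementaryTreeRankAtMost d C →
      ∃[ f ] (Elementary f × (∀ G → C G → ∀ r → ∇̃≤ r G (f r))))
proposition7p2 d C = boundedExpansion , elementaryExpansion
  where
  boundedExpansion : ExcludedMiddle 0ℓ → TreeRankAtMost d C → BoundedExpansion C
  boundedExpansion em rank r =
    let T , T-tree , T∉ = excludedTree em rank r
    in 4 * n T , λ G G∈C → ∇̃≤-of-excluded-tree T-tree T∉ G∈C

  elementaryExpansion : ElementaryTreeRankAtMost d C →
                        ∃[ f ] (Elementary f × (∀ G → C G → ∀ r → ∇̃≤ r G (f r)))
  elementaryExpansion (f , f-elementary , excluded) =
    (λ r → 4 * f r) , Elementary-4* f-elementary , λ G G∈C r →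
      let T , T-tree , |T|≡ , T∉ = excluded r
      in subst (λ m → ∇̃≤ r G (4 * m)) |T|≡ (∇̃≤-of-excluded-tree T-tree T∉ G∈C)
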